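{- Let $G$ be an abelian group, $S=\{s_1,\dots,s_n\}\subseteq G$ a finite, independent, generating subset, and $A\subseteq G$ finite. Then for any $i,j\in[1,n]$, $$|\{a\in[A]_i: a+s_j\notin[A]_i\}|\le|\{a\in A: a+s_j\notin A\}|.$$ Consequently, $\partial_S([A]_i)\le\partial_S(A)$.
   Context: $S$ independent and generating means that for each $i$, with $S_i:=S\setminus\{s_i\}$, $G=\langle S_i\rangle\oplus\langle s_i\rangle$. Let $K_i:=[0,\operatorname{ord}(s_i))\cap\mathbb{Z}$ if $s_i$ has finite order and $K_i:=\mathbb{Z}$ otherwise; every $g\in G$ has a unique representation $g=h+ks_i$ with $h\in\langle S_i\rangle$, $k\in K_i$. The compression along $s_i$ is $[A]_i:=\{g=h+ks_i: h\in\langle S_i\rangle,\ k\in K_i,\ 0\le k<|(g+\langle s_i\rangle)\cap A|\}$. $\partial_S(A)=|\{(a,s)\in A\times S: a+s\notin A\}|$. -}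

module Defs where

open import Data.Nat as ℕ using (ℕ; NonZero)
open import Data.Integer as ℤ using (ℤ; +_; 0ℤ; 1ℤ; _+_; _≤?_; _<?_)
open import Data.Integer.DivMod using (_%ℕ_)
open import Data.Integer.Properties using () renaming (_≟_ to _≟ℤ_)
open import Data.Fin using (Fin; _≟_)
open import Data.Fin.Properties using ()
open import Data.Vec as Vec using (Vec; []; _∷_; lookup; _[_]≔_; tabulate; replicate)
open import Data.Vec.Properties using (≡-dec)
open import Data.List as List using (List; length; filter; map; allFin)
open import Data.Nat.ListAction using (sum)
import Data.List.Membership.DecPropositional as DecMem
open import Data.Unit using (⊤; tt)
open import Data.Product using (_×_; _,_)
open import Relation.Nullary using (Dec; yes; no; ¬?)
open import Relation.Nullary.Decidable using (_×-dec_)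

-- The order of a generator s_i: infinite, or finite m ≥ 1.
data Ord : Set where
  inf : Ord
  fin : (m : ℕ) → .{{_ : NonZero m}} → Ord

-- The group G = ⊕_i ⟨s_i⟩ (S independent and generating), in coordinates:
-- g = Σ k_i s_i with k_i ∈ K_i, stored as the vector (k_1,…,k_n).
-- K_i = ℤ for infinite order, [0,m) for order m.
InK : Ord → ℤ → Set
InK inf z = ⊤
InK (fin m) z = (+ 0 ℤ.≤ z) × (z ℤ.< + m)

InK? : (o : Ord) (z : ℤ) → Dec (InK o z)
InK? inf z = yes tt
InK? (fin m) z = (+ 0 ≤? z) ×-dec (z <? + m)

Canon : ∀ {n} → Vec Ord n → Vec ℤ n → Set
Canon [] [] = ⊤
Canon (o ∷ os) (z ∷ zs) = InK o z × Canon os zs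

Canon? : ∀ {n} (os : Vec Ord n) (g : Vec ℤ n) → Dec (Canon os g)
Canon? [] [] = yes tt
Canon? (o ∷ os) (z ∷ zs) = InK? o z ×-dec Canon? os zs

red : Ord → ℤ → ℤ
red inf z = z
red (fin m) z = + (z %ℕ m)

add : ∀ {n} → Vec Ord n → Vec ℤ n → Vec ℤ n → Vec ℤ n
add [] [] [] = []
add (o ∷ os) (x ∷ xs) (y ∷ ys) = red o (x + y) ∷ add os xs ys

gen : ∀ {n} → Vec Ord n → Fin n → Vec ℤ n
gen os j = add os (replicate _ 0ℤ) (tabulate (λ k → unit k))
  where
  unit : _ → ℤ
  unit k with k ≟ j
  ... | yes _ = 1ℤ
  ... | no _ = 0ℤ

-- g = h + k s_i with h ∈ ⟨S_i⟩, k ∈ K_i : the h-component and the k-component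
hpart : ∀ {n} → Fin n → Vec ℤ n → Vec ℤ n
hpart i g = g [ i ]≔ 0ℤ

kpart : ∀ {n} → Fin n → Vec ℤ n → ℤ
kpart i g = lookup g i

-- |(g + ⟨s_i⟩) ∩ A|  (a ∈ g + ⟨s_i⟩ iff a and g have the same h-component)
lineCount : ∀ {n} → Fin n → List (Vec ℤ n) → Vec ℤ n → ℕ
lineCount i A g = length (filter (λ a → ≡-dec _≟ℤ_ (hpart i a) (hpart i g)) A)

InComp : ∀ {n} → Vec Ord n → List (Vec ℤ n) → Fin n → Vec ℤ n → Set
InComp os A i g = Canon os g × ((+ 0 ℤ.≤ kpart i g) × (kpart i g ℤ.< + lineCount i A g))

InComp? : ∀ {n} (os : Vec Ord n) (A : List (Vec ℤ n)) (i : Fin n) (g : Vec ℤ n) → Dec (InComp os A i g)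
InComp? os A i g = Canon? os g ×-dec ((+ 0 ≤? kpart i g) ×-dec (kpart i g <? + lineCount i A g))

-- |{a ∈ A : a + s_j ∉ A}|  for a finite set A given as a duplicate-free list
bdry : ∀ {n} → Vec Ord n → List (Vec ℤ n) → Fin n → ℕ
bdry {n} os A j = length (filter (λ a → ¬? (add os a (gen os j) ∈? A)) A)
  where open DecMem (≡-dec {n = n} _≟ℤ_) using (_∈?_)

-- |{a ∈ [A]_i : a + s_j ∉ [A]_i}|, where L is a duplicate-free enumeration of [A]_i
bdryComp : ∀ {n} → Vec Ord n → List (Vec ℤ n) → Fin n → List (Vec ℤ n) → Fin n → ℕ
bdryComp os A i L j = length (filter (λ g → ¬? (InComp? os A i (add os g (gen os j)))) L)

∂S : ∀ {n} → Vec Ord n → List (Vec ℤ n) → ℕ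
∂S {n} os A = sum (map (bdry os A) (allFin n))

∂SComp : ∀ {n} → Vec Ord n → List (Vec ℤ n) → Fin n → List (Vec ℤ n) → ℕ
∂SComp {n} os A i L = sum (map (bdryComp os A i L) (allFin n))

module Submission where

-- Coordinates: G = ⊕ ⟨s_k⟩, a point is its vector of coordinates, and the lines
-- along s_i are the cosets g + ⟨s_i⟩, i.e. the fibres of g ↦ hpart i g.  On each
-- line, [A]_i is the initial segment [0, c) of K_i, where c is the number of
-- points of A on that line.  Both boundary counts split as sums over lines
-- (`compare-by-lines`), so it suffices to compare them line by line.
--
--  * j ≠ i: adding s_j maps the line h to the line h + s_j, keeping the i-th
--    coordinate.  The escaping points of [A]_i on line h are the levels in
--    [c(h + s_j), c(h)), while at most c(h + s_j) points of A on line h stay in A,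
--    so at least c(h) − c(h + s_j) of them leave A.
--  * j = i: adding s_i moves along the line, so only the top level c − 1 of the
--    segment can escape, and only if c < |K_i|.  If then no point of A on the line
--    left A, its set of coordinates would be closed under k ↦ k + 1 in K_i, hence
--    contain more than c elements (`closed-fills`), which is absurd.

open import Defs
open import Data.Nat using (ℕ; zero; suc; pred; _+_; _∸_; _≤_; _<_; z≤n; s≤s; NonZero)
open import Data.Nat.Properties as ℕP using ()
open import Data.Nat.DivMod using (_%_; m<n⇒m%n≡m; n%n≡0; m%n≤m)
open import Data.Nat.ListAction using (sum)
open import Algebra.Properties.CommutativeSemigroup ℕP.+-commutativeSemigroup
  using () renaming (interchange to +-interchange)
open import Data.Integer as ℤ using (ℤ; +_; 0ℤ; 1ℤ; ∣_∣; +≤+; +<+)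
import Data.Integer.Properties as ℤP
open import Data.Integer.Properties using () renaming (_≟_ to _≟ℤ_)
open import Data.Integer.DivMod using (n%ℕd<d)
open import Algebra.Properties.AbelianGroup ℤP.+-0-abelianGroup using (∙-cancelˡ; ∙-cancelʳ)
open import Data.Fin as Fin using (Fin; zero; suc)
open import Data.Vec using (Vec; []; _∷_; lookup; replicate; tabulate)
open import Data.Vec.Properties
  using (≡-dec; lookup∘update; lookup∘update′; lookup-replicate; lookup∘tabulate;
         tabulate∘lookup; tabulate-cong)
open import Data.List using (List; []; _∷_; length; filter; map; upTo; allFin; deduplicate; _++_)
open import Data.List.Properties
  using (length-upTo; length-map; length-removeAt′; map-cong; filter-some)
open import Data.List.Relation.Unary.All as All using (All)
open import Data.List.Relation.Unary.All.Properties using (¬Any⇒All¬)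
open import Data.List.Relation.Unary.Any using (here; there; index; any?)
open import Data.List.Relation.Unary.AllPairs using (_∷_)
open import Data.List.Relation.Unary.Unique.Propositional using (Unique)
open import Data.List.Relation.Unary.Unique.Propositional.Properties using (filter⁺; map⁺; upTo⁺)
open import Data.List.Relation.Unary.Unique.DecPropositional.Properties using (deduplicate-!)
open import Data.List.Membership.Propositional using (_∈_; _─_)
open import Data.List.Membership.Propositional.Properties
  using (∈-filter⁺; ∈-filter⁻; ∈-map⁺; ∈-map⁻; ∈-upTo⁺; ∈-upTo⁻; ∈-deduplicate⁺; ∈-++⁺ˡ; ∈-++⁺ʳ)
import Data.List.Membership.DecPropositional as DecMembership
open import Data.Product using (_×_; _,_; proj₁; proj₂; ∃-syntax)
open import Data.Sum using (_⊎_; inj₁; inj₂)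
open import Data.Unit using (⊤; tt)
open import Data.Empty using (⊥-elim)
open import Function using (_∘_; id)
open import Relation.Nullary using (yes; no; ¬_; ¬?)
open import Relation.Nullary.Decidable using (decidable-stable)
open import Level using (0ℓ)
open import Relation.Unary using (Pred; Decidable)
open import Relation.Binary.Definitions using (DecidableEquality)
open import Relation.Binary.PropositionalEquality

private variable
  X Y : Set

∈-─ : ∀ {x z : X} {xs} (p : x ∈ xs) → z ∈ xs → z ≢ x → z ∈ xs ─ p
∈-─ (here refl) (here refl) z≢x = ⊥-elim (z≢x refl)
∈-─ (here refl) (there q)   _   = q
∈-─ (there p)   (here refl) _   = here refl
∈-─ (there p)   (there q)   z≢x = there (∈-─ p q z≢x)

injection-length : (f : X → Y) {xs : List X} {ys : List Y} → Unique xs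
  → (∀ {x y} → x ∈ xs → y ∈ xs → f x ≡ f y → x ≡ y)
  → (∀ {x} → x ∈ xs → f x ∈ ys)
  → length xs ≤ length ys
injection-length f {[]}     _             _   _    = z≤n
injection-length f {x ∷ xs} {ys} (x∉xs ∷ uxs) inj into =
  subst (suc (length xs) ≤_) (sym (length-removeAt′ ys (index fx∈ys)))
    (s≤s (injection-length f uxs (λ p q → inj (there p) (there q)) into-rest))
  where
  fx∈ys : f x ∈ ys
  fx∈ys = into (here refl)
  into-rest : ∀ {y} → y ∈ xs → f y ∈ ys ─ fx∈ys
  into-rest y∈xs = ∈-─ fx∈ys (into (there y∈xs))
    (λ fy≡fx → All.lookup x∉xs y∈xs (sym (inj (there y∈xs) (here refl) fy≡fx)))

interval-length : (f : X → ℕ) {xs : List X} {lo hi : ℕ} → Unique xs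
  → (∀ {x y} → x ∈ xs → y ∈ xs → f x ≡ f y → x ≡ y)
  → (∀ {x} → x ∈ xs → lo ≤ f x × f x < hi)
  → length xs ≤ hi ∸ lo
interval-length f {xs} {lo} {hi} uxs inj range =
  subst (length xs ≤_) (length-upTo (hi ∸ lo))
    (injection-length (λ x → f x ∸ lo) uxs shifted-inj
      (λ x∈ → ∈-upTo⁺ (ℕP.∸-monoˡ-< (proj₂ (range x∈)) (proj₁ (range x∈)))))
  where
  shifted-inj : ∀ {x y} → x ∈ xs → y ∈ xs → f x ∸ lo ≡ f y ∸ lo → x ≡ y
  shifted-inj p q e = inj p q (ℕP.∸-cancelʳ-≡ (proj₁ (range p)) (proj₁ (range q)) e)

member-of-nonempty : ∀ {xs : List X} → 0 < length xs → ∃[ x ] x ∈ xs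
member-of-nonempty {xs = x ∷ _} _ = x , here refl

length-≤-by-witness : ∀ (xs : List X) {r} → length xs ≤ 1 → (∀ {x} → x ∈ xs → 1 ≤ r) → length xs ≤ r
length-≤-by-witness []       _  _       = z≤n
length-≤-by-witness (x ∷ xs) ≤1 witness = ℕP.≤-trans ≤1 (witness (here refl))

length-filter-split : {P : Pred X 0ℓ} (P? : Decidable P) (xs : List X)
  → length xs ≡ length (filter P? xs) + length (filter (¬? ∘ P?) xs)
length-filter-split P? []       = refl
length-filter-split P? (x ∷ xs) with P? x
... | yes _ = cong suc (length-filter-split P? xs)
... | no  _ = trans (cong suc (length-filter-split P? xs)) (sym (ℕP.+-suc _ _))

sum-mono-≤ : (f g : X → ℕ) (ks : List X) → (∀ k → f k ≤ g k) → sum (map f ks) ≤ sum (map g ks)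
sum-mono-≤ f g []       _   = z≤n
sum-mono-≤ f g (k ∷ ks) f≤g = ℕP.+-mono-≤ (f≤g k) (sum-mono-≤ f g ks f≤g)

sum-map-+ : (f g : X → ℕ) (ks : List X) → sum (map (λ k → f k + g k) ks) ≡ sum (map f ks) + sum (map g ks)
sum-map-+ f g []       = refl
sum-map-+ f g (k ∷ ks) =
  trans (cong (λ w → f k + g k + w) (sum-map-+ f g ks))
        (+-interchange (f k) (g k) (sum (map f ks)) (sum (map g ks)))

sum-zero : (f : X → ℕ) (ks : List X) → (∀ {h} → h ∈ ks → f h ≡ 0) → sum (map f ks) ≡ 0
sum-zero f []       _      = refl
sum-zero f (k ∷ ks) vanish = cong₂ _+_ (vanish (here refl)) (sum-zero f ks (vanish ∘ there))

sum-single : (f : X → ℕ) {k : X} {ks : List X} → Unique ks → k ∈ ks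
  → (∀ h → h ≢ k → f h ≡ 0) → sum (map f ks) ≡ f k
sum-single f (k∉ks ∷ _) (here refl) support =
  trans (cong (λ w → f _ + w) (sum-zero f _ (λ h∈ → support _ (λ h≡k → All.lookup k∉ks h∈ (sym h≡k)))))
        (ℕP.+-identityʳ _)
sum-single f (h∉ks ∷ uks) (there k∈ks) support =
  cong₂ _+_ (support _ (λ h≡k → All.lookup h∉ks k∈ks h≡k)) (sum-single f uks k∈ks support)

module Lines {X K : Set} (_≟K_ : DecidableEquality K) (κ : X → K) where

  line : K → List X → List X
  line h = filter (λ x → κ x ≟K h)

  ∈-line⁺ : ∀ {h x xs} → x ∈ xs → κ x ≡ h → x ∈ line h xs
  ∈-line⁺ {h} = ∈-filter⁺ (λ x → κ x ≟K h)

  ∈-line⁻ : ∀ {h x} xs → x ∈ line h xs → x ∈ xs × κ x ≡ h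
  ∈-line⁻ {h} xs = ∈-filter⁻ (λ x → κ x ≟K h) {xs = xs}

  ∈-line-filter⁻ : ∀ {P : Pred X 0ℓ} (P? : Decidable P) {h x} xs
    → x ∈ filter P? (line h xs) → (x ∈ xs × κ x ≡ h) × P x
  ∈-line-filter⁻ P? {h} xs m =
    let (x∈line , px) = ∈-filter⁻ P? m in ∈-line⁻ xs x∈line , px

  unique-line-filter : ∀ {P : Pred X 0ℓ} (P? : Decidable P) {h xs} → Unique xs
    → Unique (filter P? (line h xs))
  unique-line-filter P? {h} uxs = filter⁺ P? (filter⁺ (λ x → κ x ≟K h) uxs)

  countOn : {P : Pred X 0ℓ} → Decidable P → List X → K → ℕ
  countOn P? xs h = length (filter P? (line h xs))

  countOn-point : {P : Pred X 0ℓ} (P? : Decidable P) (x : X) (h : K) → h ≢ κ x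
    → countOn P? (x ∷ []) h ≡ 0
  countOn-point P? x h h≢κx with κ x ≟K h
  ... | yes κx≡h = ⊥-elim (h≢κx (sym κx≡h))
  ... | no  _    = refl

  countOn-own : {P : Pred X 0ℓ} (P? : Decidable P) (x : X)
    → countOn P? (x ∷ []) (κ x) ≡ length (filter P? (x ∷ []))
  countOn-own P? x with κ x ≟K κ x
  ... | yes _     = refl
  ... | no  κx≢κx = ⊥-elim (κx≢κx refl)

  countOn-point-sum : {P : Pred X 0ℓ} (P? : Decidable P) (x : X) {ks : List K} → Unique ks → κ x ∈ ks
    → sum (map (countOn P? (x ∷ [])) ks) ≡ length (filter P? (x ∷ []))
  countOn-point-sum P? x uks κx∈ks =
    trans (sum-single (countOn P? (x ∷ [])) uks κx∈ks (countOn-point P? x)) (countOn-own P? x)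

  countOn-∷ : {P : Pred X 0ℓ} (P? : Decidable P) (x : X) (xs : List X) (h : K)
    → countOn P? (x ∷ xs) h ≡ countOn P? (x ∷ []) h + countOn P? xs h
  countOn-∷ P? x xs h with κ x ≟K h
  ... | no  _ = refl
  ... | yes _ with P? x
  ...   | yes _ = refl
  ...   | no  _ = refl

  length-filter-∷ : {P : Pred X 0ℓ} (P? : Decidable P) (x : X) (xs : List X)
    → length (filter P? (x ∷ xs)) ≡ length (filter P? (x ∷ [])) + length (filter P? xs)
  length-filter-∷ P? x xs with P? x
  ... | yes _ = refl
  ... | no  _ = refl

  count-by-lines : {P : Pred X 0ℓ} (P? : Decidable P) {ks : List K} → Unique ks → (xs : List X)
    → (∀ {x} → x ∈ xs → κ x ∈ ks) → length (filter P? xs) ≡ sum (map (countOn P? xs) ks)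
  count-by-lines P? {ks} uks []       _     = sym (sum-zero (countOn P? []) ks (λ _ → refl))
  count-by-lines P? {ks} uks (x ∷ xs) keyed = begin
    length (filter P? (x ∷ xs))
      ≡⟨ length-filter-∷ P? x xs ⟩
    length (filter P? (x ∷ [])) + length (filter P? xs)
      ≡⟨ cong₂ _+_ (sym (countOn-point-sum P? x uks (keyed (here refl))))
                   (count-by-lines P? uks xs (keyed ∘ there)) ⟩
    sum (map (countOn P? (x ∷ [])) ks) + sum (map (countOn P? xs) ks)
      ≡⟨ sym (sum-map-+ (countOn P? (x ∷ [])) (countOn P? xs) ks) ⟩
    sum (map (λ h → countOn P? (x ∷ []) h + countOn P? xs h) ks)
      ≡⟨ cong sum (map-cong (λ h → sym (countOn-∷ P? x xs h)) ks) ⟩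
    sum (map (countOn P? (x ∷ xs)) ks)  ∎
    where open ≡-Reasoning

  compare-by-lines : {P Q : Pred X 0ℓ} (P? : Decidable P) (Q? : Decidable Q) (xs ys : List X)
    → (∀ h → countOn P? xs h ≤ countOn Q? ys h) → length (filter P? xs) ≤ length (filter Q? ys)
  compare-by-lines P? Q? xs ys line-wise =
    subst₂ _≤_ (sym (count-by-lines P? uks xs (λ x∈ → keyed (∈-++⁺ˡ x∈))))
               (sym (count-by-lines Q? uks ys (λ y∈ → keyed (∈-++⁺ʳ xs y∈))))
               (sum-mono-≤ (countOn P? xs) (countOn Q? ys) keys line-wise)
    where
    keys : List K
    keys = deduplicate _≟K_ (map κ (xs ++ ys))
    uks : Unique keys
    uks = deduplicate-! _≟K_ (map κ (xs ++ ys))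
    keyed : ∀ {x} → x ∈ xs ++ ys → κ x ∈ keys
    keyed x∈ = ∈-deduplicate⁺ _≟K_ (∈-map⁺ κ x∈)

-- The step k ↦ k + 1 inside K = ℤ or K = [0, m): the i-th coordinate of g + s_i
-- as a function of the i-th coordinate of g.
step : Ord → ℤ → ℤ
step o z = red o (z ℤ.+ red o 1ℤ)

suc-mod-cases : ∀ m .{{_ : NonZero m}} {a} → a < m
  → (suc a < m × (a + 1 % m) % m ≡ suc a) ⊎ (suc a ≡ m × (a + 1 % m) % m ≡ 0)
suc-mod-cases (suc zero)    {zero}  _ = inj₂ (refl , refl)
suc-mod-cases (suc zero)    {suc a} (s≤s ())
suc-mod-cases (suc (suc m)) {a}     a<m with ℕP.m≤n⇒m<n∨m≡n a<m
... | inj₁ sa<m = inj₁ (sa<m , trans (cong (_% suc (suc m)) (ℕP.+-comm a 1)) (m<n⇒m%n≡m sa<m))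
... | inj₂ sa≡m = inj₂ (sa≡m , trans (cong (_% suc (suc m)) (trans (ℕP.+-comm a 1) sa≡m))
                                    (n%n≡0 (suc (suc m))))

step-injective : ∀ o {x y} → InK o x → InK o y → step o x ≡ step o y → x ≡ y
step-injective inf     {x} {y} _ _ e = ∙-cancelʳ 1ℤ x y e
step-injective (fin m) {+ a} {+ b} (_ , +<+ a<m) (_ , +<+ b<m) e
  with suc-mod-cases m a<m | suc-mod-cases m b<m | ℤP.+-injective e
... | inj₁ (_ , ea) | inj₁ (_ , eb) | e′ = cong +_ (ℕP.suc-injective (trans (sym ea) (trans e′ eb)))
... | inj₂ (ea , _) | inj₂ (eb , _) | _  = cong +_ (ℕP.suc-injective (trans ea (sym eb)))
... | inj₁ (_ , ea) | inj₂ (_ , eb) | e′ with () ← trans (sym ea) (trans e′ eb)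
... | inj₂ (_ , ea) | inj₁ (_ , eb) | e′ with () ← trans (sym eb) (trans (sym e′) ea)

step-bound : ∀ o a → ∃[ r ] step o (+ a) ≡ + r × r ≤ suc a
step-bound inf     a = a + 1 , refl , ℕP.≤-reflexive (ℕP.+-comm a 1)
step-bound (fin m) a = (a + 1 % m) % m , refl ,
  ℕP.≤-trans (m%n≤m (a + 1 % m) m)
    (ℕP.≤-trans (ℕP.+-monoʳ-≤ a (m%n≤m 1 m)) (ℕP.≤-reflexive (ℕP.+-comm a 1)))

Fits : Ord → ℕ → Set
Fits inf     N = ⊤
Fits (fin m) N = N ≤ m

step-leaves-top : ∀ o {a c} → InK o (+ a) → suc a ≡ c → ¬ (step o (+ a) ℤ.< + c) → Fits o (suc c)
step-leaves-top inf     _            _    _     = tt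
step-leaves-top (fin m) (_ , +<+ a<m) refl leaves with suc-mod-cases m a<m
... | inj₁ (sa<m , _)  = sa<m
... | inj₂ (_ , wraps) = ⊥-elim (leaves (subst (λ r → + r ℤ.< + suc _) (sym wraps) (+<+ (s≤s z≤n))))

cyclic-closed-full : ∀ m .{{_ : NonZero m}} (Q : ℕ → Set)
  → (∀ {r} → r < m → Q r → Q ((r + 1 % m) % m))
  → ∀ {r₀} → r₀ < m → Q r₀ → ∀ {r} → r < m → Q r
cyclic-closed-full m Q next r₀<m q₀ = climb q-zero z≤n
  where
  -- Q propagates from b upwards to every r < m, since below the top there is no wrap-around.
  climb : ∀ {b r} → Q b → b ≤ r → r < m → Q r
  climb {r = zero}  qb z≤n   _    = qb
  climb {r = suc r} qb b≤1+r 1+r<m with ℕP.m≤n⇒m<n∨m≡n b≤1+r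
  ... | inj₂ refl = qb
  ... | inj₁ b<1+r with suc-mod-cases m r<m | next r<m (climb qb (ℕP.≤-pred b<1+r) r<m)
    where r<m = ℕP.<-trans (ℕP.n<1+n r) 1+r<m
  ...   | inj₁ (_ , no-wrap) | q = subst Q no-wrap q
  ...   | inj₂ (1+r≡m , _)   | _ = ⊥-elim (ℕP.<-irrefl 1+r≡m 1+r<m)
  top<m : pred m < m
  top<m = ℕP.m≤pred[n]⇒suc[m]≤n ℕP.≤-refl
  -- climbing from r₀ reaches the top m − 1, whose successor is 0
  q-zero : Q 0
  q-zero with suc-mod-cases m top<m | next top<m (climb q₀ (ℕP.<⇒≤pred r₀<m) top<m)
  ... | inj₂ (_ , wraps)  | q = subst Q wraps q
  ... | inj₁ (1+top<m , _) | _ = ⊥-elim (ℕP.<-irrefl (ℕP.suc-pred m) 1+top<m)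

natural : ∀ {m} .{{_ : NonZero m}} {z} → InK (fin m) z → ∃[ r ] z ≡ + r × r < m
natural {z = + r} (_ , +<+ r<m) = r , refl , r<m

closed-fills : ∀ o (P : ℤ → Set) → (∀ {z} → P z → InK o z × P (step o z)) → ∀ {z₀} → P z₀
  → ∀ N → Fits o N → ∃[ zs ] Unique zs × All P zs × length zs ≡ N
closed-fills inf P closed {z₀} p₀ N _ =
  map orbit (upTo N) , map⁺ orbit-injective (upTo⁺ N) , All.tabulate orbit-in-P ,
  trans (length-map orbit (upTo N)) (length-upTo N)
  where
  orbit : ℕ → ℤ
  orbit t = z₀ ℤ.+ + t
  orbit-P : ∀ t → P (orbit t)
  orbit-P zero    = subst P (sym (ℤP.+-identityʳ z₀)) p₀
  orbit-P (suc t) =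
    subst P (trans (ℤP.+-assoc z₀ (+ t) 1ℤ) (cong (λ w → z₀ ℤ.+ + w) (ℕP.+-comm t 1)))
            (proj₂ (closed (orbit-P t)))
  orbit-injective : ∀ {t u} → orbit t ≡ orbit u → t ≡ u
  orbit-injective e = ℤP.+-injective (∙-cancelˡ z₀ _ _ e)
  orbit-in-P : ∀ {z} → z ∈ map orbit (upTo N) → P z
  orbit-in-P z∈ with ∈-map⁻ orbit z∈
  ... | t , _ , refl = orbit-P t
closed-fills (fin m) P closed {z₀} p₀ N N≤m with natural (proj₁ (closed p₀))
... | r₀ , refl , r₀<m =
  map +_ (upTo N) , map⁺ ℤP.+-injective (upTo⁺ N) , All.tabulate in-P ,
  trans (length-map +_ (upTo N)) (length-upTo N)
  where
  everywhere : ∀ {r} → r < m → P (+ r)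
  everywhere = cyclic-closed-full m (P ∘ +_) (λ _ → proj₂ ∘ closed) r₀<m p₀
  in-P : ∀ {z} → z ∈ map +_ (upTo N) → P z
  in-P z∈ with ∈-map⁻ +_ z∈
  ... | t , t∈ , refl = everywhere (ℕP.<-≤-trans (∈-upTo⁻ t∈) N≤m)

shift : ∀ {n} → Vec Ord n → Fin n → Vec ℤ n → Vec ℤ n
shift os j g = add os g (gen os j)

vec-ext : ∀ {n} {xs ys : Vec ℤ n} → (∀ k → lookup xs k ≡ lookup ys k) → xs ≡ ys
vec-ext {xs = xs} {ys} same =
  trans (sym (tabulate∘lookup xs)) (trans (tabulate-cong same) (tabulate∘lookup ys))

lookup-add : ∀ {n} (os : Vec Ord n) x y k
  → lookup (add os x y) k ≡ red (lookup os k) (lookup x k ℤ.+ lookup y k)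
lookup-add (o ∷ os) (x ∷ xs) (y ∷ ys) zero    = refl
lookup-add (o ∷ os) (x ∷ xs) (y ∷ ys) (suc k) = lookup-add os xs ys k

lookup-canonical : ∀ {n} (os : Vec Ord n) {g} → Canon os g → ∀ k → InK (lookup os k) (lookup g k)
lookup-canonical (o ∷ os) {z ∷ zs} (z∈K , zs∈K) zero    = z∈K
lookup-canonical (o ∷ os) {z ∷ zs} (z∈K , zs∈K) (suc k) = lookup-canonical os zs∈K k

red-canonical : ∀ o z → InK o (red o z)
red-canonical inf     z = tt
red-canonical (fin m) z = +≤+ z≤n , +<+ (n%ℕd<d z m)

add-canonical : ∀ {n} (os : Vec Ord n) x y → Canon os (add os x y)
add-canonical []       []       []       = tt
add-canonical (o ∷ os) (x ∷ xs) (y ∷ ys) = red-canonical o (x ℤ.+ y) , add-canonical os xs ys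

red-zero : ∀ o → red o 0ℤ ≡ 0ℤ
red-zero inf           = refl
red-zero (fin (suc m)) = refl

red-canonical-id : ∀ o {z} → InK o z → red o z ≡ z
red-canonical-id inf     _ = refl
red-canonical-id (fin m) z∈K with natural z∈K
... | _ , refl , r<m = cong +_ (m<n⇒m%n≡m r<m)

-- Its definition tabulates a local indicator
-- function `unit` of j; stating this for an arbitrary vector v equal to the
-- generator lets Agda solve for `unit` when the lemma is applied to gen os j.
lookup-generator : ∀ {n} (os : Vec Ord n) (unit : Fin n → ℤ) k {v}
  → v ≡ add os (replicate n 0ℤ) (tabulate unit) → lookup v k ≡ red (lookup os k) (0ℤ ℤ.+ unit k)
lookup-generator {n} os unit k refl = trans (lookup-add os (replicate n 0ℤ) (tabulate unit) k)
  (cong₂ (λ a b → red (lookup os k) (a ℤ.+ b)) (lookup-replicate k 0ℤ) (lookup∘tabulate unit k))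

lookup-gen-same : ∀ {n} (os : Vec Ord n) j → lookup (gen os j) j ≡ red (lookup os j) 1ℤ
lookup-gen-same os j with lookup-generator os _ j {gen os j} refl
... | e with j Fin.≟ j
...   | yes _  = e
...   | no j≢j = ⊥-elim (j≢j refl)

lookup-gen-other : ∀ {n} (os : Vec Ord n) {j k} → k ≢ j → lookup (gen os j) k ≡ 0ℤ
lookup-gen-other os {j} {k} k≢j with lookup-generator os _ k {gen os j} refl
... | e with k Fin.≟ j
...   | no _    = trans e (red-zero (lookup os k))
...   | yes k≡j = ⊥-elim (k≢j k≡j)

lookup-shift-same : ∀ {n} (os : Vec Ord n) j x
  → lookup (shift os j x) j ≡ step (lookup os j) (lookup x j)
lookup-shift-same os j x = trans (lookup-add os x (gen os j) j)
  (cong (λ w → red (lookup os j) (lookup x j ℤ.+ w)) (lookup-gen-same os j))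

lookup-shift-other : ∀ {n} (os : Vec Ord n) {j x} → Canon os x → ∀ {k} → k ≢ j
  → lookup (shift os j x) k ≡ lookup x k
lookup-shift-other os {j} {x} x∈G {k} k≢j = begin
  lookup (shift os j x) k
    ≡⟨ lookup-add os x (gen os j) k ⟩
  red (lookup os k) (lookup x k ℤ.+ lookup (gen os j) k)
    ≡⟨ cong (λ w → red (lookup os k) (lookup x k ℤ.+ w)) (lookup-gen-other os k≢j) ⟩
  red (lookup os k) (lookup x k ℤ.+ 0ℤ)
    ≡⟨ cong (red (lookup os k)) (ℤP.+-identityʳ (lookup x k)) ⟩
  red (lookup os k) (lookup x k)
    ≡⟨ red-canonical-id (lookup os k) (lookup-canonical os x∈G k) ⟩
  lookup x k  ∎
  where open ≡-Reasoning

shift-injective : ∀ {n} (os : Vec Ord n) j {x y} → Canon os x → Canon os y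
  → shift os j x ≡ shift os j y → x ≡ y
shift-injective os j {x} {y} x∈G y∈G e = vec-ext same
  where
  same : ∀ k → lookup x k ≡ lookup y k
  same k with k Fin.≟ j
  ... | yes refl = step-injective (lookup os k) (lookup-canonical os x∈G k) (lookup-canonical os y∈G k)
                     (trans (sym (lookup-shift-same os k x))
                       (trans (cong (λ v → lookup v k) e) (lookup-shift-same os k y)))
  ... | no k≢j   = trans (sym (lookup-shift-other os x∈G k≢j))
                     (trans (cong (λ v → lookup v k) e) (lookup-shift-other os y∈G k≢j))

components-determine : ∀ {n} (i : Fin n) {g g′ : Vec ℤ n} → hpart i g ≡ hpart i g′ → kpart i g ≡ kpart i g′
  → g ≡ g′
components-determine i {g} {g′} eh ek = vec-ext same
  where
  same : ∀ k → lookup g k ≡ lookup g′ k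
  same k with k Fin.≟ i
  ... | yes refl = ek
  ... | no k≢i   = trans (sym (lookup∘update′ k≢i g 0ℤ))
                     (trans (cong (λ v → lookup v k) eh) (lookup∘update′ k≢i g′ 0ℤ))

hpart-shift-other : ∀ {n} (os : Vec Ord n) {i j} → j ≢ i → ∀ x
  → hpart i (shift os j x) ≡ shift os j (hpart i x)
hpart-shift-other os {i} {j} j≢i x = vec-ext same
  where
  open ≡-Reasoning
  same : ∀ k → lookup (hpart i (shift os j x)) k ≡ lookup (shift os j (hpart i x)) k
  same k with k Fin.≟ i
  ... | yes refl = begin
    lookup (hpart i (shift os j x)) k
      ≡⟨ lookup∘update k (shift os j x) 0ℤ ⟩
    0ℤ
      ≡⟨ sym (red-zero (lookup os k)) ⟩
    red (lookup os k) (0ℤ ℤ.+ 0ℤ)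
      ≡⟨ sym (cong₂ (λ a b → red (lookup os k) (a ℤ.+ b))
                    (lookup∘update k x 0ℤ) (lookup-gen-other os (j≢i ∘ sym))) ⟩
    red (lookup os k) (lookup (hpart i x) k ℤ.+ lookup (gen os j) k)
      ≡⟨ sym (lookup-add os (hpart i x) (gen os j) k) ⟩
    lookup (shift os j (hpart i x)) k  ∎
  ... | no k≢i   = begin
    lookup (hpart i (shift os j x)) k
      ≡⟨ lookup∘update′ k≢i (shift os j x) 0ℤ ⟩
    lookup (shift os j x) k
      ≡⟨ lookup-add os x (gen os j) k ⟩
    red (lookup os k) (lookup x k ℤ.+ lookup (gen os j) k)
      ≡⟨ cong (λ a → red (lookup os k) (a ℤ.+ lookup (gen os j) k)) (sym (lookup∘update′ k≢i x 0ℤ)) ⟩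
    red (lookup os k) (lookup (hpart i x) k ℤ.+ lookup (gen os j) k)
      ≡⟨ sym (lookup-add os (hpart i x) (gen os j) k) ⟩
    lookup (shift os j (hpart i x)) k  ∎

hpart-shift-same : ∀ {n} (os : Vec Ord n) i {x} → Canon os x → hpart i (shift os i x) ≡ hpart i x
hpart-shift-same os i {x} x∈G = vec-ext same
  where
  same : ∀ k → lookup (hpart i (shift os i x)) k ≡ lookup (hpart i x) k
  same k with k Fin.≟ i
  ... | yes refl = trans (lookup∘update k (shift os i x) 0ℤ) (sym (lookup∘update k x 0ℤ))
  ... | no k≢i   = trans (lookup∘update′ k≢i (shift os i x) 0ℤ)
                     (trans (lookup-shift-other os x∈G k≢i) (sym (lookup∘update′ k≢i x 0ℤ)))

module CompressionBoundary {n : ℕ} (os : Vec Ord n) (A : List (Vec ℤ n))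
  (A⊆G : All (Canon os) A) (uA : Unique A) (i : Fin n) (L : List (Vec ℤ n)) (uL : Unique L)
  (L=[A]ᵢ : ∀ g → (g ∈ L → InComp os A i g) × (InComp os A i g → g ∈ L)) where

  open Lines (≡-dec _≟ℤ_) (hpart i)
  open DecMembership (≡-dec {n = n} _≟ℤ_) using (_∈?_)

  count : Vec ℤ n → ℕ
  count h = length (line h A)

  level : Vec ℤ n → ℕ
  level g = ∣ kpart i g ∣

  escapes? : (j : Fin n) → Decidable (λ g → ¬ InComp os A i (shift os j g))
  escapes? j g = ¬? (InComp? os A i (shift os j g))

  leaves? : (j : Fin n) → Decidable (λ a → ¬ shift os j a ∈ A)
  leaves? j a = ¬? (shift os j a ∈? A)

  in-G : ∀ {a} → a ∈ A → Canon os a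
  in-G = All.lookup A⊆G

  member-L : ∀ {g} → g ∈ L → Canon os g × kpart i g ≡ + level g × level g < count (hpart i g)
  member-L {g} g∈L with proj₁ (L=[A]ᵢ g) g∈L
  ... | g∈G , 0≤k , k<c = g∈G , k≡level , ℤP.drop‿+<+ (subst (ℤ._< + count (hpart i g)) k≡level k<c)
    where
    k≡level : kpart i g ≡ + level g
    k≡level = sym (ℤP.0≤i⇒+∣i∣≡i 0≤k)

  in-compression : ∀ {g h} → Canon os g → 0ℤ ℤ.≤ kpart i g → hpart i g ≡ h → kpart i g ℤ.< + count h
    → InComp os A i g
  in-compression g∈G 0≤k refl k<c = g∈G , 0≤k , k<c

  level-injective : ∀ {P : Pred (Vec ℤ n) 0ℓ} (P? : Decidable P) {h g g′}
    → g ∈ filter P? (line h L) → g′ ∈ filter P? (line h L) → level g ≡ level g′ → g ≡ g′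
  level-injective P? p q el =
    let ((g∈L , eg) , _) = ∈-line-filter⁻ P? L p
        ((g′∈L , eg′) , _) = ∈-line-filter⁻ P? L q
    in components-determine i (trans eg (sym eg′))
         (trans (proj₁ (proj₂ (member-L g∈L)))
           (trans (cong +_ el) (sym (proj₁ (proj₂ (member-L g′∈L))))))

  module OffAxis {j : Fin n} (j≢i : j ≢ i) (h : Vec ℤ n) where

    h′ : Vec ℤ n
    h′ = shift os j h

    -- A point of line h escaping [A]_i keeps its level on the line h + s_j, which
    -- is therefore at least the count of A there.
    escape-level : ∀ {g} → g ∈ L → hpart i g ≡ h → ¬ InComp os A i (shift os j g) → count h′ ≤ level g
    escape-level {g} g∈L eh escapes = ℕP.≮⇒≥ λ level<c′ →
      escapes (in-compression (add-canonical os g (gen os j))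
                 (subst (0ℤ ℤ.≤_) (sym k′≡level) (+≤+ z≤n))
                 (trans (hpart-shift-other os j≢i g) (cong (shift os j) eh))
                 (subst (ℤ._< + count h′) (sym k′≡level) (+<+ level<c′)))
      where
      k′≡level : kpart i (shift os j g) ≡ + level g
      k′≡level = trans (lookup-shift-other os (proj₁ (member-L g∈L)) (j≢i ∘ sym))
                       (proj₁ (proj₂ (member-L g∈L)))

    -- The escaping points of line h have distinct levels in [count (h + s_j), count h).
    escaping-L : countOn (escapes? j) L h ≤ count h ∸ count h′
    escaping-L =
      interval-length level (unique-line-filter (escapes? j) uL) (level-injective (escapes? j)) range
      where
      range : ∀ {g} → g ∈ filter (escapes? j) (line h L) → count h′ ≤ level g × level g < count h
      range {g} p = let ((g∈L , eg) , escapes) = ∈-line-filter⁻ (escapes? j) L p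
                    in escape-level g∈L eg escapes ,
                       subst (λ v → level g < count v) eg (proj₂ (proj₂ (member-L g∈L)))

    -- The points of A on line h staying in A translate injectively into line h + s_j.
    staying-A : countOn (¬? ∘ leaves? j) A h ≤ count h′
    staying-A = injection-length (shift os j) (unique-line-filter (¬? ∘ leaves? j) uA) injective into
      where
      injective : ∀ {a b} → a ∈ filter (¬? ∘ leaves? j) (line h A) → b ∈ filter (¬? ∘ leaves? j) (line h A)
        → shift os j a ≡ shift os j b → a ≡ b
      injective p q = shift-injective os j (in-G (proj₁ (proj₁ (∈-line-filter⁻ _ A p))))
                                          (in-G (proj₁ (proj₁ (∈-line-filter⁻ _ A q))))
      into : ∀ {a} → a ∈ filter (¬? ∘ leaves? j) (line h A) → shift os j a ∈ line h′ A
      into {a} p = let ((_ , ea) , stays) = ∈-line-filter⁻ (¬? ∘ leaves? j) A p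
                   in ∈-line⁺ (decidable-stable (shift os j a ∈? A) stays)
                              (trans (hpart-shift-other os j≢i a) (cong (shift os j) ea))

    leaving-A : count h ∸ count h′ ≤ countOn (leaves? j) A h
    leaving-A = ℕP.m≤n+o⇒m∸n≤o (count h) (count h′) (begin
      count h                                                 ≡⟨ length-filter-split (leaves? j) (line h A) ⟩
      countOn (leaves? j) A h + countOn (¬? ∘ leaves? j) A h  ≤⟨ ℕP.+-monoʳ-≤ leaving staying-A ⟩
      leaving + count h′                                      ≡⟨ ℕP.+-comm leaving (count h′) ⟩
      count h′ + leaving                                      ∎)
      where
      open ℕP.≤-Reasoning
      leaving = countOn (leaves? j) A h

    line-bound : countOn (escapes? j) L h ≤ countOn (leaves? j) A h
    line-bound = ℕP.≤-trans escaping-L leaving-A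

  module OnAxis (h : Vec ℤ n) where

    oᵢ : Ord
    oᵢ = lookup os i

    escape-top : ∀ {g} → g ∈ L → hpart i g ≡ h → ¬ InComp os A i (shift os i g)
      → suc (level g) ≡ count h × Fits oᵢ (suc (count h))
    escape-top {g} g∈L eh escapes with member-L g∈L | step-bound oᵢ (level g)
    ... | g∈G , k≡level , level<c | r , step≡r , r≤1+level = top , step-leaves-top oᵢ level∈K top leaves
      where
      k′≡step : kpart i (shift os i g) ≡ step oᵢ (+ level g)
      k′≡step = trans (lookup-shift-same os i g) (cong (step oᵢ) k≡level)
      leaves : ¬ (step oᵢ (+ level g) ℤ.< + count h)
      leaves lt = escapes (in-compression (add-canonical os g (gen os i))
        (subst (0ℤ ℤ.≤_) (sym (trans k′≡step step≡r)) (+≤+ z≤n))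
        (trans (hpart-shift-same os i g∈G) eh) (subst (ℤ._< + count h) (sym k′≡step) lt))
      top : suc (level g) ≡ count h
      top = ℕP.≤-antisym (subst (λ v → level g < count v) eh level<c) (ℕP.≮⇒≥ λ 1+level<c →
        leaves (subst (ℤ._< + count h) (sym step≡r) (+<+ (ℕP.≤-<-trans r≤1+level 1+level<c))))
      level∈K : InK oᵢ (+ level g)
      level∈K = subst (InK oᵢ) k≡level (lookup-canonical os g∈G i)

    escaping-L : countOn (escapes? i) L h ≤ 1
    escaping-L =
      injection-length level (unique-line-filter (escapes? i) uL) (level-injective (escapes? i)) at-top
      where
      at-top : ∀ {g} → g ∈ filter (escapes? i) (line h L) → level g ∈ pred (count h) ∷ []
      at-top p = let ((g∈L , eg) , escapes) = ∈-line-filter⁻ (escapes? i) L p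
                 in here (cong pred (proj₁ (escape-top g∈L eg escapes)))

    coordinates : List ℤ
    coordinates = map (kpart i) (line h A)

    closed-coordinates : All (λ a → shift os i a ∈ A) (line h A)
      → ∀ {z} → z ∈ coordinates → InK oᵢ z × step oᵢ z ∈ coordinates
    closed-coordinates stays z∈ with ∈-map⁻ (kpart i) z∈
    ... | a , a∈line , refl =
      lookup-canonical os a∈G i ,
      subst (_∈ coordinates) (lookup-shift-same os i a)
        (∈-map⁺ (kpart i) (∈-line⁺ (All.lookup stays a∈line) (trans (hpart-shift-same os i a∈G) ea)))
      where
      a∈G : Canon os a
      a∈G = in-G (proj₁ (∈-line⁻ A a∈line))
      ea : hpart i a ≡ h
      ea = proj₂ (∈-line⁻ A a∈line)

    closed-line : All (λ a → shift os i a ∈ A) (line h A) → 0 < count h → ¬ Fits oᵢ (suc (count h))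
    closed-line stays 0<c fits
      with a₀ , a₀∈line ← member-of-nonempty 0<c
      with zs , uzs , zs⊆ , |zs| ← closed-fills oᵢ (_∈ coordinates) (closed-coordinates stays)
                                     (∈-map⁺ (kpart i) a₀∈line) (suc (count h)) fits
      = ℕP.1+n≰n (subst₂ _≤_ |zs| (length-map (kpart i) (line h A))
                   (injection-length id uzs (λ _ _ e → e) (All.lookup zs⊆)))

    leaving-A : ∀ {g} → g ∈ filter (escapes? i) (line h L) → 1 ≤ countOn (leaves? i) A h
    leaving-A p with any? (leaves? i) (line h A)
    ... | yes some = filter-some (leaves? i) some
    ... | no none  =
      let ((g∈L , eg) , escapes) = ∈-line-filter⁻ (escapes? i) L p
          (top , fits) = escape-top g∈L eg escapes
      in ⊥-elim (closed-line stays (subst (0 <_) top (s≤s z≤n)) fits)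
      where
      stays : All (λ a → shift os i a ∈ A) (line h A)
      stays = All.map (λ {a} → decidable-stable (shift os i a ∈? A)) (¬Any⇒All¬ (line h A) none)

    line-bound : countOn (escapes? i) L h ≤ countOn (leaves? i) A h
    line-bound = length-≤-by-witness (filter (escapes? i) (line h L)) escaping-L leaving-A

  boundary-along : ∀ j → bdryComp os A i L j ≤ bdry os A j
  boundary-along j = compare-by-lines (escapes? j) (leaves? j) L A line-bound
    where
    line-bound : ∀ h → countOn (escapes? j) L h ≤ countOn (leaves? j) A h
    line-bound h with j Fin.≟ i
    ... | yes refl = OnAxis.line-bound h
    ... | no j≢i   = OffAxis.line-bound j≢i h

claim3p2 : ∀ {n : ℕ} (os : Vec Ord n) (A : List (Vec ℤ n))
    → All (Canon os) A → Unique A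
    → (i : Fin n) (L : List (Vec ℤ n)) → Unique L
    → (∀ g → (g ∈ L → InComp os A i g) × (InComp os A i g → g ∈ L))
    → ((j : Fin n) → bdryComp os A i L j ≤ bdry os A j)
    × (∂SComp os A i L ≤ ∂S os A)
claim3p2 os A A⊆G uA i L uL L=[A]ᵢ =
  boundary-along , sum-mono-≤ (bdryComp os A i L) (bdry os A) (allFin _) boundary-along
  where open CompressionBoundary os A A⊆G uA i L uL L=[A]ᵢ
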